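{- Let $\mathbb I$ be an interface. For all processes $p,q$, if $p\sqsubseteq_{\mathsf{must}}q$ then $p\sqsubseteq^{\mathrm{unc}}_{\mathbb I}q$.
   Context: Names $\mathcal N$, co-names $\bar a$ ($\bar{\bar a}=a$), $\mathsf{Act}=\mathcal N\cup\bar{\mathcal N}$, internal action $\tau\notin\mathsf{Act}$, success $\checkmark$. Processes: $p::=\mathbf 0\mid\mathbf 1\mid\mu.p\mid p+q\mid X\mid \mathrm{rec}_X.p$ ($\mu\in\mathsf{Act}\cup\{\tau\}$), with transitions $\mathbf 1\xrightarrow{\checkmark}\mathbf 0$, $\mu.p\xrightarrow{\mu}p$, choice moving as either summand, recursion unfolded. Configurations $c::=p\mid c\parallel d$: interleaving of $\mu$-moves, $\tau$-synchronisation of complementary actions $\alpha,\bar\alpha$, and $c\parallel d\xrightarrow{\checkmark}c'\parallel d'$ only when both sides do $\checkmark$. $\mathtt n(p)$: names $a$ with $a$ or $\bar a$ occurring in $p$. $p\ \mathsf{must}\ o$ iff every maximal $\tau$-computation $p\parallel o=p_0\parallel o_0\xrightarrow{\tau}p_1\parallel o_1\xrightarrow{\tau}\cdots$ (infinite or ending with no $\tau$-move) has some $j$ with $o_j\xrightarrow{\checkmark}$. Must preorder: $p\sqsubseteq_{\mathsf{must}}q$ iff for every configuration $o$, $p\ \mathsf{must}\ o$ implies $q\ \mathsf{must}\ o$. An interface is a partition $\mathbb I=\{I_i\}_{i\in0..n}$ of $\mathsf{Act}$ with $\alpha\in I_i\Rightarrow\bar\alpha\in I_i$. Uncoordinated preorder: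 $p\sqsubseteq^{\mathrm{unc}}_{\mathbb I}q$ iff for all processes $o_0,\dots,o_n$ with $\mathtt n(o_i)\subseteq I_i$, $p\ \mathsf{must}\ (o_0\parallel\cdots\parallel o_n)$ implies $q\ \mathsf{must}\ (o_0\parallel\cdots\parallel o_n)$. -}

module Defs where

open import Data.Nat using (ℕ; zero; suc; _<_; _≤_; _<ᵇ_)
open import Data.Bool using (if_then_else_)
open import Data.Fin using (Fin)
open import Data.Product using (Σ; ∃; _×_; _,_; proj₁; proj₂)
open import Data.Sum using (_⊎_)
open import Data.Empty using (⊥)
open import Relation.Nullary using (¬_)
open import Relation.Binary.PropositionalEquality using (_≡_)
open import Function.Definitions using (Surjective)

module _ {N : Set} where

  data Act : Set where
    name   : N → Act
    coname : N → Act

  bar : Act → Act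
  bar (name a)   = coname a
  bar (coname a) = name a

  data Pre : Set where
    act : Act → Pre
    tau : Pre

  data Lab : Set where
    act  : Act → Lab
    tau  : Lab
    tick : Lab

  preLab : Pre → Lab
  preLab (act α) = act α
  preLab tau     = tau

  -- processes; recursion variables are de Bruijn indices
  data Proc : Set where
    𝟘 𝟙  : Proc
    _·_  : Pre → Proc → Proc
    _⊕_  : Proc → Proc → Proc
    var  : ℕ → Proc
    rec  : Proc → Proc

  shift : ℕ → Proc → Proc
  shift c 𝟘 = 𝟘
  shift c 𝟙 = 𝟙
  shift c (μ · p) = μ · shift c p
  shift c (p ⊕ q) = shift c p ⊕ shift c q
  shift c (var x) = if x <ᵇ c then var x else var (suc x)
  shift c (rec p) = rec (shift (suc c) p)

  -- p [ s / k ] : substitute s for variable k, free variables above k move down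
  subst : ℕ → Proc → Proc → Proc
  subst k s 𝟘 = 𝟘
  subst k s 𝟙 = 𝟙
  subst k s (μ · p) = μ · subst k s p
  subst k s (p ⊕ q) = subst k s p ⊕ subst k s q
  subst k s (var x) with x <ᵇ k | k <ᵇ x
  ... | Data.Bool.true  | _ = var x
  ... | Data.Bool.false | Data.Bool.true = var (Data.Nat.pred x)
  ... | Data.Bool.false | Data.Bool.false = s
  subst k s (rec p) = rec (subst (suc k) (shift 0 s) p)

  unfold : Proc → Proc
  unfold p = subst 0 (rec p) p

  data _—[_]→_ : Proc → Lab → Proc → Set where
    succ : 𝟙 —[ tick ]→ 𝟘
    pref : ∀ {μ p} → (μ · p) —[ preLab μ ]→ p
    sumL : ∀ {p q ℓ p'} → p —[ ℓ ]→ p' → (p ⊕ q) —[ ℓ ]→ p'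
    sumR : ∀ {p q ℓ q'} → q —[ ℓ ]→ q' → (p ⊕ q) —[ ℓ ]→ q'
    unf  : ∀ {p ℓ p'} → unfold p —[ ℓ ]→ p' → rec p —[ ℓ ]→ p'

  data Occ (a : N) : Proc → Set where
    hereN : ∀ {p} → Occ a (act (name a) · p)
    hereC : ∀ {p} → Occ a (act (coname a) · p)
    under : ∀ {μ p} → Occ a p → Occ a (μ · p)
    inL   : ∀ {p q} → Occ a p → Occ a (p ⊕ q)
    inR   : ∀ {p q} → Occ a q → Occ a (p ⊕ q)
    inRec : ∀ {p} → Occ a p → Occ a (rec p)

  data Conf : Set where
    proc : Proc → Conf
    _∥_  : Conf → Conf → Conf

  data _—[_]⇒_ : Conf → Lab → Conf → Set where
    lift : ∀ {p ℓ p'} → p —[ ℓ ]→ p' → proc p —[ ℓ ]⇒ proc p'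
    parL : ∀ {c d μ c'} → c —[ preLab μ ]⇒ c' → (c ∥ d) —[ preLab μ ]⇒ (c' ∥ d)
    parR : ∀ {c d μ d'} → d —[ preLab μ ]⇒ d' → (c ∥ d) —[ preLab μ ]⇒ (c ∥ d')
    sync : ∀ {c d α c' d'} → c —[ act α ]⇒ c' → d —[ act (bar α) ]⇒ d'
         → (c ∥ d) —[ tau ]⇒ (c' ∥ d')
    both : ∀ {c d c' d'} → c —[ tick ]⇒ c' → d —[ tick ]⇒ d'
         → (c ∥ d) —[ tick ]⇒ (c' ∥ d')

  -- states p_j ∥ o_j of a computation of p ∥ o, recorded as the pair (p_j , o_j)
  State : Set
  State = Proc × Conf

  _⟶_ : State → State → Set
  (p , o) ⟶ (p' , o') = (proc p ∥ o) —[ tau ]⇒ (proc p' ∥ o')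

  Stuck : State → Set
  Stuck s = ¬ (Σ State λ s' → s ⟶ s')

  data Maximal (s : ℕ → State) : Set where
    infinite : (∀ j → s j ⟶ s (suc j)) → Maximal s
    finite   : (n : ℕ) → (∀ j → j < n → s j ⟶ s (suc j)) → Stuck (s n) → Maximal s

  -- the computation reaches a state whose tester component can do ✓
  -- (in the finite case the index must lie within the computation)
  Succeeds : (s : ℕ → State) → Maximal s → Set
  Succeeds s m = Σ ℕ λ j → InRange m j × Σ Conf λ o' → proj₂ (s j) —[ tick ]⇒ o'
    where
    InRange : Maximal s → ℕ → Set
    InRange (infinite _)   j = Data.Unit.⊤
      where import Data.Unit
    InRange (finite n _ _) j = j ≤ n

  _must_ : Proc → Conf → Set
  p must o = (s : ℕ → State) → s 0 ≡ (p , o) → (m : Maximal s) → Succeeds s m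

  _⊑must_ : Proc → Proc → Set
  p ⊑must q = (o : Conf) → p must o → q must o

  -- an interface {I_i}_{i ∈ 0..n}: block assignment of actions, a partition
  -- (every block nonempty) closed under complementation
  record Interface (n : ℕ) : Set where
    field
      blk      : Act → Fin (suc n)
      blk-bar  : ∀ α → blk (bar α) ≡ blk α
      nonempty : ∀ i → Σ Act λ α → blk α ≡ i

  parAll : ∀ {n} → (Fin (suc n) → Proc) → Conf
  parAll {zero}  o = proc (o Fin.zero)
  parAll {suc n} o = proc (o Fin.zero) ∥ parAll (λ i → o (Fin.suc i))

  ⊑unc : ∀ {n} → Interface n → Proc → Proc → Set
  ⊑unc {n} 𝕀 p q =
    (o : Fin (suc n) → Proc) →
    (∀ i a → Occ a (o i) → Interface.blk 𝕀 (name a) ≡ i) →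
    p must parAll o → q must parAll o

module Submission where

open import Data.Nat using (ℕ)
open import Defs

-- The testers of ⊑unc are configurations respecting the interface, so they are
-- among the testers of ⊑must.
proposition5p2 : {N : Set} (n : ℕ) (𝕀 : Interface {N} n) (p q : Proc {N}) →
    p ⊑must q → ⊑unc 𝕀 p q
proposition5p2 n 𝕀 p q p⊑q o _ = p⊑q (parAll o)
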